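{- Let $n\ge2$, $\sigma,\tau\in\mathfrak{S}_n$ with $\tau\lessdot\sigma$, say $\tau s_i=\sigma$ with $i\in\mathrm{Des}(\sigma)$, and regard $G(\tau)$ as the induced subgraph of $G(\sigma)$ on $\{ti:t\in\mathcal{R}(\tau)\}$. Let $I_i=\{j\in\mathrm{Des}(\sigma): |j-i|>1\}$. (1) If $I_i\neq\emptyset$, then the number of commutation edges incident to vertices of $G(\tau)$ but not contained in $G(\tau)$ is $\sum_{j\in I_i}|\mathcal{R}(\sigma s_is_j)|$. (2) If $I_i=\emptyset$, then every commutation edge incident to a vertex of $G(\tau)$ has both endpoints in $G(\tau)$.
   Context: $\mathfrak{S}_n$ is the symmetric group on $[n]$ with simple transpositions $s_i=(i\ i+1)$; $\ell$ is the inversion number; $\mathcal{R}(\sigma)$ is the set of reduced words of $\sigma$ (words $i_1\cdots i_l$ with $l=\ell(\sigma)$ and $\sigma=s_{i_1}\cdots s_{i_l}$); $\mathrm{Des}(\sigma)=\{i:\sigma(i)>\sigma(i+1)\}$; $\tau\lessdot\sigma$ means $\sigma=\tau s_i$ with $\ell(\sigma)=\ell(\tau)+1$. $G(\sigma)$ is the graph on $\mathcal{R}(\sigma)$ with commutation edges joining words related by a single move $ab\to ba$ on adjacent letters with $|a-b|>1$, and braid edges joining words related by a single move $a(a+1)a\leftrightarrow(a+1)a(a+1)$ on adjacent letters. -}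

module Defs where

open import Data.Bool using (if_then_else_)
open import Data.Nat using (ℕ; zero; suc; _<_; _<?_; ∣_-_∣; _∸_)
open import Data.Nat.Properties using (_≟_)
open import Data.List using (List; []; _∷_; _++_; [_]; map; filter; length; upTo; concatMap; foldl; cartesianProduct)
open import Data.List.Properties using (≡-dec)
open import Data.List.Relation.Binary.Permutation.Propositional using (_↭_)
open import Data.Product using (_×_; _,_)
open import Relation.Nullary using (does; ¬?)
open import Relation.Nullary.Decidable using (_×-dec_)
open import Relation.Binary using (DecidableEquality)
import Data.List.Membership.DecPropositional as DecMem

_≟L_ : DecidableEquality (List ℕ)
_≟L_ = ≡-dec _≟_

open DecMem _≟L_ using (_∈?_) renaming (_∈_ to _∈W_)

-- Permutations of [n] = {1,…,n} in one-line notation [σ(1), …, σ(n)].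
idPerm : ℕ → List ℕ
idPerm n = map suc (upTo n)

IsPerm : ℕ → List ℕ → Set
IsPerm n σ = σ ↭ idPerm n

-- σ(k) for 1 ≤ k ≤ n (1-indexed lookup; default 0 out of range)
at : List ℕ → ℕ → ℕ
at []       _             = 0
at (x ∷ xs) zero          = 0
at (x ∷ xs) (suc zero)    = x
at (x ∷ xs) (suc (suc k)) = at xs (suc k)

swapAt : ℕ → List ℕ → List ℕ
swapAt zero          xs           = xs
swapAt (suc zero)    (x ∷ y ∷ xs) = y ∷ x ∷ xs
swapAt (suc zero)    xs           = xs
swapAt (suc (suc k)) []           = []
swapAt (suc (suc k)) (x ∷ xs)     = x ∷ swapAt (suc k) xs

-- Right multiplication by the simple transposition s_i: (σ s_i)(k) = σ(s_i(k)),
-- i.e. swap positions i and i+1 of the one-line notation.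
_·s_ : List ℕ → ℕ → List ℕ
σ ·s i = swapAt i σ

evalWord : ℕ → List ℕ → List ℕ
evalWord n w = foldl _·s_ (idPerm n) w

inv : List ℕ → ℕ
inv []       = 0
inv (x ∷ xs) = length (filter (λ y → y <? x) xs) + inv xs
  where open Data.Nat using (_+_)

letters : ℕ → List ℕ
letters n = map suc (upTo (n ∸ 1))

wordsOfLength : ℕ → ℕ → List (List ℕ)
wordsOfLength n zero    = [ [] ]
wordsOfLength n (suc l) = concatMap (λ a → map (a ∷_) (wordsOfLength n l)) (letters n)

reducedWords : ℕ → List ℕ → List (List ℕ)
reducedWords n σ = filter (λ w → evalWord n w ≟L σ) (wordsOfLength n (inv σ))

Des : ℕ → List ℕ → List ℕ
Des n σ = filter (λ j → at σ (suc j) <? at σ j) (letters n)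

Iset : ℕ → List ℕ → ℕ → List ℕ
Iset n σ i = filter (λ j → 1 <? ∣ j - i ∣) (Des n σ)

commNbrs : List ℕ → List (List ℕ)
commNbrs []           = []
commNbrs (a ∷ [])     = []
commNbrs (a ∷ b ∷ s)  =
  (if does (1 <? ∣ a - b ∣) then [ b ∷ a ∷ s ] else [])
  ++ map (a ∷_) (commNbrs (b ∷ s))

vertsSub : ℕ → List ℕ → ℕ → List (List ℕ)
vertsSub n τ i = map (_++ [ i ]) (reducedWords n τ)

-- Number of commutation edges of G(σ) incident to a vertex of G(τ) but not
-- contained in G(τ): each such edge {u,v} has exactly one endpoint u in G(τ),
-- so it is counted as the ordered pair (u, v) with u ∈ V(G(τ)), v ∉ V(G(τ)),
-- u, v ∈ ℛ(σ), and v obtained from u by one commutation move.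
boundaryCommEdges : ℕ → List ℕ → List ℕ → ℕ → ℕ
boundaryCommEdges n σ τ i =
  length (filter (λ { (u , v) → (u ∈? vertsSub n τ i)
                               ×-dec (¬? (v ∈? vertsSub n τ i))
                               ×-dec (v ∈? commNbrs u) })
                 (cartesianProduct (reducedWords n σ) (reducedWords n σ)))

CommEdge : ℕ → List ℕ → List ℕ → List ℕ → Set
CommEdge n σ u v = (u ∈W reducedWords n σ) × (v ∈W reducedWords n σ) × (v ∈W commNbrs u)

InSub : ℕ → List ℕ → ℕ → List ℕ → Set
InSub n τ i u = u ∈W vertsSub n τ i

-- The vertices of G(τ) are the reduced words of σ ending in i; the last letter of any reduced
-- word of σ is a descent of σ. A commutation move that does not touch the last letter keeps the
-- word ending in i, so the only commutation edges leaving G(τ) are w j i — w i j with |j − i| > 1.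
-- Then j is the last letter of the reduced word w i j of σ, so j ∈ I_i, and w ∈ ℛ(σ s_i s_j);
-- conversely every j ∈ I_i and w ∈ ℛ(σ s_i s_j) give such an edge, injectively in (j, w).
-- Counting these edges gives (1); when I_i = ∅ there are none, which is (2).
module Submission where

open import Defs
open import Data.Bool using (true; false; T)
open import Data.List
  using (List; []; _∷_; _++_; [_]; _∷ʳ_; map; filter; length; upTo; concatMap; foldl;
         cartesianProduct; initLast; _∷ʳ′_)
open import Data.List.Membership.Propositional using (_∈_; find; lose)
open import Data.List.Membership.Propositional.Properties
open import Data.List.Membership.Propositional.Properties.WithK using (unique∧set⇒bag)
open import Data.List.Properties using (++-assoc; ∷ʳ-++; ∷ʳ-injective; ∷ʳ-injectiveˡ; ∷ʳ-injectiveʳ;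
  foldl-++; length-++; length-map; length-upTo; map-cong; filter-accept; filter-reject;
  filter-none; ∷-injectiveʳ)
open import Data.List.Relation.Binary.BagAndSetEquality using (∼bag⇒↭)
open import Data.List.Relation.Binary.Permutation.Propositional
  using (_↭_; ↭-refl; ↭-sym; ↭-trans; prep; swap; ↭⇒↭ₛ)
open import Data.List.Relation.Binary.Permutation.Propositional.Properties using (↭-length; filter-↭)
open import Data.List.Relation.Binary.Permutation.Setoid.Properties using (Unique-resp-↭)
open import Data.List.Relation.Unary.All using (All; []; _∷_)
import Data.List.Relation.Unary.All as All
open import Data.List.Relation.Unary.All.Properties using (∷ʳ⁺; ∷ʳ⁻)
open import Data.List.Relation.Unary.AllPairs using (AllPairs; []; _∷_)
import Data.List.Relation.Unary.AllPairs.Properties as AllPairs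
open import Data.List.Relation.Unary.Any using (here)
open import Data.List.Relation.Unary.Unique.Propositional using (Unique)
import Data.List.Relation.Unary.Unique.Propositional.Properties as Unique
open import Data.Nat using (ℕ; zero; suc; _≤_; _<_; _<ᵇ_; _+_; z≤n; s≤s; s<s⁻¹; _<?_; ∣_-_∣; _∸_)
open import Data.Nat.ListAction using (sum)
open import Data.Nat.Properties
  using (+-suc; +-comm; +-identityʳ; ≤-refl; ≤-trans; ≤-reflexive; n≤1+n; m<n⇒m<1+n; <-asym; <-cmp;
         <-irrefl; n≮0; m≢1+n+m; +-monoʳ-≤; +-monoˡ-≤; ∣n-n∣≡0; ∣-∣-comm; suc-injective; <ᵇ⇒<; <⇒<ᵇ;
         +-commutativeSemigroup; module ≤-Reasoning)
open import Algebra.Properties.CommutativeSemigroup +-commutativeSemigroup using (x∙yz≈y∙xz)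
open import Data.Product as Product using (_×_; _,_; proj₁; proj₂)
open import Data.Sum as Sum using (_⊎_; inj₁; inj₂)
open import Data.Unit using (tt)
open import Function using (id)
open import Function.Bundles using (_⇔_; mk⇔; Equivalence)
open import Relation.Binary.Definitions using (tri<; tri≈; tri>)
open import Relation.Binary.PropositionalEquality
  using (_≡_; _≢_; refl; sym; trans; cong; cong₂; subst; subst₂; setoid)
open import Relation.Nullary using (¬_; does; contradiction)
open import Relation.Unary using (Decidable)

swapAt-involutive : ∀ k (xs : List ℕ) → swapAt k (swapAt k xs) ≡ xs
swapAt-involutive zero          xs           = refl
swapAt-involutive (suc zero)    []           = refl
swapAt-involutive (suc zero)    (x ∷ [])     = refl
swapAt-involutive (suc zero)    (x ∷ y ∷ xs) = refl
swapAt-involutive (suc (suc k)) []           = refl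
swapAt-involutive (suc (suc k)) (x ∷ xs)     = cong (x ∷_) (swapAt-involutive (suc k) xs)

swapAt-↭ : ∀ k (xs : List ℕ) → swapAt k xs ↭ xs
swapAt-↭ zero          xs           = ↭-refl
swapAt-↭ (suc zero)    []           = ↭-refl
swapAt-↭ (suc zero)    (x ∷ [])     = ↭-refl
swapAt-↭ (suc zero)    (x ∷ y ∷ xs) = swap y x ↭-refl
swapAt-↭ (suc (suc k)) []           = ↭-refl
swapAt-↭ (suc (suc k)) (x ∷ xs)     = prep x (swapAt-↭ (suc k) xs)

far-apart : ∀ a b → 1 < ∣ a - b ∣ → suc a < b ⊎ suc b < a
far-apart zero    b       h = inj₁ h
far-apart (suc a) zero    h = inj₂ h
far-apart (suc a) (suc b) h = Sum.map s≤s s≤s (far-apart a b h)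

far-apart⇒≢ : ∀ a b → 1 < ∣ a - b ∣ → a ≢ b
far-apart⇒≢ a .a h refl = n≮0 (subst (1 <_) (∣n-n∣≡0 a) h)

swapAt-comm-< : ∀ a b (xs : List ℕ) → suc a < b → swapAt a (swapAt b xs) ≡ swapAt b (swapAt a xs)
swapAt-comm-< zero                b                   xs           _ = refl
swapAt-comm-< (suc zero)          (suc (suc (suc m))) []           _ = refl
swapAt-comm-< (suc zero)          (suc (suc (suc m))) (x ∷ [])     _ = refl
swapAt-comm-< (suc zero)          (suc (suc (suc m))) (x ∷ y ∷ xs) _ = refl
swapAt-comm-< (suc zero)          (suc zero)          _            (s≤s ())
swapAt-comm-< (suc zero)          (suc (suc zero))    _            (s≤s (s≤s ()))
swapAt-comm-< (suc (suc a))       (suc zero)          _            (s≤s ())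
swapAt-comm-< (suc (suc a))       (suc (suc b))       []           _ = refl
swapAt-comm-< (suc (suc a))       (suc (suc b))       (x ∷ xs)     h =
  cong (x ∷_) (swapAt-comm-< (suc a) (suc b) xs (s<s⁻¹ h))

swapAt-comm : ∀ a b (xs : List ℕ) → 1 < ∣ a - b ∣ → swapAt a (swapAt b xs) ≡ swapAt b (swapAt a xs)
swapAt-comm a b xs h with far-apart a b h
... | inj₁ a+1<b = swapAt-comm-< a b xs a+1<b
... | inj₂ b+1<a = sym (swapAt-comm-< b a xs b+1<a)

at-swapAt-left : ∀ a (xs : List ℕ) → 1 ≤ a → suc a ≤ length xs → at (swapAt a xs) a ≡ at xs (suc a)
at-swapAt-left (suc zero)    (x ∷ y ∷ xs) _ _       = refl
at-swapAt-left (suc zero)    (x ∷ [])     _ (s≤s ())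
at-swapAt-left (suc (suc a)) (x ∷ xs)     _ (s≤s h) = at-swapAt-left (suc a) xs (s≤s z≤n) h

at-swapAt-right : ∀ a (xs : List ℕ) → 1 ≤ a → suc a ≤ length xs → at (swapAt a xs) (suc a) ≡ at xs a
at-swapAt-right (suc zero)    (x ∷ y ∷ xs) _ _       = refl
at-swapAt-right (suc zero)    (x ∷ [])     _ (s≤s ())
at-swapAt-right (suc (suc a)) (x ∷ xs)     _ (s≤s h) = at-swapAt-right (suc a) xs (s≤s z≤n) h

at-swapAt-outside : ∀ a k (xs : List ℕ) → k < a ⊎ suc a < k → at (swapAt a xs) k ≡ at xs k
at-swapAt-outside zero          k                   xs           _ = refl
at-swapAt-outside (suc zero)    k                   []           _ = refl
at-swapAt-outside (suc zero)    k                   (x ∷ [])     _ = refl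
at-swapAt-outside (suc zero)    zero                (x ∷ y ∷ xs) _ = refl
at-swapAt-outside (suc zero)    (suc zero)          (x ∷ y ∷ xs) (inj₁ (s≤s ()))
at-swapAt-outside (suc zero)    (suc zero)          (x ∷ y ∷ xs) (inj₂ (s≤s ()))
at-swapAt-outside (suc zero)    (suc (suc zero))    (x ∷ y ∷ xs) (inj₁ (s≤s ()))
at-swapAt-outside (suc zero)    (suc (suc zero))    (x ∷ y ∷ xs) (inj₂ (s≤s (s≤s ())))
at-swapAt-outside (suc zero)    (suc (suc (suc k))) (x ∷ y ∷ xs) _ = refl
at-swapAt-outside (suc (suc a)) k                   []           _ = refl
at-swapAt-outside (suc (suc a)) zero                (x ∷ xs)     _ = refl
at-swapAt-outside (suc (suc a)) (suc zero)          (x ∷ xs)     _ = refl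
at-swapAt-outside (suc (suc a)) (suc (suc k))       (x ∷ xs)     h =
  at-swapAt-outside (suc a) (suc k) xs (Sum.map s<s⁻¹ s<s⁻¹ h)

at-unique : ∀ a (xs : List ℕ) → Unique xs → 1 ≤ a → suc a ≤ length xs → at xs a ≢ at xs (suc a)
at-unique (suc zero)    (x ∷ y ∷ xs) ((x≢y ∷ _) ∷ _) _ _       = x≢y
at-unique (suc zero)    (x ∷ [])     _              _ (s≤s ())
at-unique (suc (suc a)) (x ∷ xs)     (_ ∷ xs!)      _ (s≤s h) = at-unique (suc a) xs xs! (s≤s z≤n) h

private
  count< : ℕ → List ℕ → ℕ
  count< x xs = length (filter (_<? x) xs)

  count<-swapAt : ∀ x k (xs : List ℕ) → count< x (swapAt k xs) ≡ count< x xs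
  count<-swapAt x k xs = ↭-length (filter-↭ (_<? x) (swapAt-↭ k xs))

  count<-∷-≤ : ∀ x y (xs : List ℕ) → count< x (y ∷ xs) ≤ suc (count< x xs)
  count<-∷-≤ x y xs with does (y <? x)
  ... | true  = ≤-refl
  ... | false = n≤1+n _

  count<-∷-≥ : ∀ x y (xs : List ℕ) → count< x xs ≤ count< x (y ∷ xs)
  count<-∷-≥ x y xs with does (y <? x)
  ... | true  = n≤1+n _
  ... | false = ≤-refl

inv-swapAt-ascent : ∀ a (xs : List ℕ) → 1 ≤ a → suc a ≤ length xs → at xs a < at xs (suc a) →
  inv (swapAt a xs) ≡ suc (inv xs)
inv-swapAt-ascent (suc zero) (x ∷ y ∷ zs) _ _ x<y
  rewrite filter-accept (_<? y) {x} {zs} x<y | filter-reject (_<? x) {y} {zs} (<-asym x<y)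
  = cong suc (x∙yz≈y∙xz (count< y zs) (count< x zs) (inv zs))
inv-swapAt-ascent (suc (suc a)) (x ∷ xs) _ (s≤s h) lt =
  trans (cong₂ _+_ (count<-swapAt x (suc a) xs) (inv-swapAt-ascent (suc a) xs (s≤s z≤n) h lt))
        (+-suc (count< x xs) (inv xs))

inv-swapAt-≤ : ∀ a (xs : List ℕ) → inv (swapAt a xs) ≤ suc (inv xs)
inv-swapAt-≤ zero          xs           = n≤1+n _
inv-swapAt-≤ (suc zero)    []           = z≤n
inv-swapAt-≤ (suc zero)    (x ∷ [])     = n≤1+n _
inv-swapAt-≤ (suc zero)    (x ∷ y ∷ zs) = begin
  count< y (x ∷ zs) + (count< x zs + inv zs)   ≤⟨ +-monoˡ-≤ _ (count<-∷-≤ y x zs) ⟩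
  suc (count< y zs + (count< x zs + inv zs))   ≡⟨ cong suc (x∙yz≈y∙xz (count< y zs) (count< x zs) (inv zs)) ⟩
  suc (count< x zs + (count< y zs + inv zs))   ≤⟨ s≤s (+-monoˡ-≤ _ (count<-∷-≥ x y zs)) ⟩
  suc (count< x (y ∷ zs) + (count< y zs + inv zs)) ∎
  where open ≤-Reasoning
inv-swapAt-≤ (suc (suc a)) []           = z≤n
inv-swapAt-≤ (suc (suc a)) (x ∷ xs)     = begin
  count< x (swapAt (suc a) xs) + inv (swapAt (suc a) xs) ≡⟨ cong (_+ _) (count<-swapAt x (suc a) xs) ⟩
  count< x xs + inv (swapAt (suc a) xs)                  ≤⟨ +-monoʳ-≤ _ (inv-swapAt-≤ (suc a) xs) ⟩
  count< x xs + suc (inv xs)                             ≡⟨ +-suc (count< x xs) (inv xs) ⟩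
  suc (count< x xs + inv xs)                             ∎
  where open ≤-Reasoning

inv-foldl-swapAt-≤ : ∀ (π w : List ℕ) → inv (foldl _·s_ π w) ≤ inv π + length w
inv-foldl-swapAt-≤ π []      = ≤-reflexive (sym (+-identityʳ (inv π)))
inv-foldl-swapAt-≤ π (a ∷ w) = begin
  inv (foldl _·s_ (swapAt a π) w) ≤⟨ inv-foldl-swapAt-≤ (swapAt a π) w ⟩
  inv (swapAt a π) + length w     ≤⟨ +-monoˡ-≤ (length w) (inv-swapAt-≤ a π) ⟩
  suc (inv π) + length w          ≡⟨ sym (+-suc (inv π) (length w)) ⟩
  inv π + length (a ∷ w)          ∎
  where open ≤-Reasoning

inv-sorted : ∀ (xs : List ℕ) → AllPairs _<_ xs → inv xs ≡ 0
inv-sorted []       _            = refl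
inv-sorted (x ∷ xs) (x<xs ∷ xs<) rewrite filter-none (_<? x) (All.map <-asym x<xs) = inv-sorted xs xs<

idPerm-sorted : ∀ n → AllPairs _<_ (idPerm n)
idPerm-sorted n = AllPairs.map⁺ (AllPairs.applyUpTo⁺₁ id n (λ i<j _ → s≤s i<j))

inv-evalWord-≤ : ∀ n w → inv (evalWord n w) ≤ length w
inv-evalWord-≤ n w = ≤-trans (inv-foldl-swapAt-≤ (idPerm n) w)
  (≤-reflexive (cong (_+ length w) (inv-sorted (idPerm n) (idPerm-sorted n))))

IsPerm⇒Unique : ∀ {n π} → IsPerm n π → Unique π
IsPerm⇒Unique {n} π↭id =
  Unique-resp-↭ (setoid ℕ) (↭⇒↭ₛ (↭-sym π↭id)) (Unique.map⁺ suc-injective (Unique.upTo⁺ n))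

IsPerm⇒length : ∀ {n π} → IsPerm n π → length π ≡ n
IsPerm⇒length {n} π↭id = trans (↭-length π↭id) (trans (length-map suc (upTo n)) (length-upTo n))

IsPerm-swapAt : ∀ {n π} a → IsPerm n π → IsPerm n (π ·s a)
IsPerm-swapAt {π = π} a π↭id = ↭-trans (swapAt-↭ a π) π↭id

∈-letters⁻ : ∀ {n a} → a ∈ letters n → 1 ≤ a × suc a ≤ n
∈-letters⁻ {zero}  a∈ with _ , k∈ , refl ← ∈-map⁻ suc a∈ = contradiction (∈-upTo⁻ k∈) n≮0
∈-letters⁻ {suc n} a∈ with _ , k∈ , refl ← ∈-map⁻ suc a∈ = s≤s z≤n , s≤s (∈-upTo⁻ k∈)

∈-letters⁺ : ∀ {n a} → 1 ≤ a → suc a ≤ n → a ∈ letters n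
∈-letters⁺ {suc n} {suc a} _ (s≤s a<n) = ∈-map⁺ suc (∈-upTo⁺ a<n)

letters-unique : ∀ n → Unique (letters n)
letters-unique n = Unique.map⁺ suc-injective (Unique.upTo⁺ (n ∸ 1))

letter-in-range : ∀ {n π a} → IsPerm n π → a ∈ letters n → 1 ≤ a × suc a ≤ length π
letter-in-range π-perm a∈ with 1≤a , a<n ← ∈-letters⁻ a∈ =
  1≤a , subst (_ ≤_) (sym (IsPerm⇒length π-perm)) a<n

∈-Des⁻ : ∀ n π {a} → a ∈ Des n π → a ∈ letters n × at π (suc a) < at π a
∈-Des⁻ n π = ∈-filter⁻ (λ j → at π (suc j) <? at π j) {xs = letters n}

∈-Des⁺ : ∀ n π {a} → a ∈ letters n → at π (suc a) < at π a → a ∈ Des n π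
∈-Des⁺ n π = ∈-filter⁺ (λ j → at π (suc j) <? at π j)

∈-Iset⁻ : ∀ n π i {j} → j ∈ Iset n π i → j ∈ Des n π × 1 < ∣ j - i ∣
∈-Iset⁻ n π i = ∈-filter⁻ (λ j → 1 <? ∣ j - i ∣) {xs = Des n π}

∈-Iset⁺ : ∀ n π i {j} → j ∈ Des n π → 1 < ∣ j - i ∣ → j ∈ Iset n π i
∈-Iset⁺ n π i = ∈-filter⁺ (λ j → 1 <? ∣ j - i ∣)

Iset-unique : ∀ n π i → Unique (Iset n π i)
Iset-unique n π i =
  Unique.filter⁺ (λ j → 1 <? ∣ j - i ∣) (Unique.filter⁺ (λ j → at π (suc j) <? at π j) (letters-unique n))

inv-swapAt-descent : ∀ {n π a} → IsPerm n π → a ∈ Des n π → inv π ≡ suc (inv (π ·s a))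
inv-swapAt-descent {n} {π} {a} π-perm a∈Des
  with a∈ , desc ← ∈-Des⁻ n π a∈Des
  with 1≤a , a<len ← letter-in-range π-perm a∈ =
  trans (cong inv (sym (swapAt-involutive a π)))
        (inv-swapAt-ascent a (swapAt a π) 1≤a a<len′ ascent)
  where
    a<len′ : suc a ≤ length (swapAt a π)
    a<len′ = subst (suc a ≤_) (sym (↭-length (swapAt-↭ a π))) a<len
    ascent : at (swapAt a π) a < at (swapAt a π) (suc a)
    ascent = subst₂ _<_ (sym (at-swapAt-left a π 1≤a a<len)) (sym (at-swapAt-right a π 1≤a a<len)) desc

descent-or-lengthens : ∀ {n π a} → IsPerm n π → a ∈ letters n →
  a ∈ Des n π ⊎ inv (π ·s a) ≡ suc (inv π)
descent-or-lengthens {n} {π} {a} π-perm a∈ with 1≤a , a<len ← letter-in-range π-perm a∈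
  with <-cmp (at π a) (at π (suc a))
... | tri< asc _ _ = inj₂ (inv-swapAt-ascent a π 1≤a a<len asc)
... | tri≈ _ eq _  = contradiction eq (at-unique a π (IsPerm⇒Unique π-perm) 1≤a a<len)
... | tri> _ _ des = inj₁ (∈-Des⁺ n π a∈ des)

Des-swapAt-far : ∀ n π {i j} → 1 < ∣ j - i ∣ → j ∈ Des n π → j ∈ Des n (π ·s i)
Des-swapAt-far n π {i} {j} far j∈Des with j∈ , desc ← ∈-Des⁻ n π j∈Des =
  ∈-Des⁺ n (π ·s i) j∈ (subst₂ _<_ (sym (at-swapAt-outside i (suc j) π suc-j-outside))
                        (sym (at-swapAt-outside i j π j-outside)) desc)
  where
    j-outside : j < i ⊎ suc i < j
    j-outside = Sum.map (≤-trans (n≤1+n _)) id (far-apart j i far)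
    suc-j-outside : suc j < i ⊎ suc i < suc j
    suc-j-outside = Sum.map id (m<n⇒m<1+n) (far-apart j i far)

unique-concatMap : ∀ {A B : Set} (f : A → List B) {xs : List A} → Unique xs → (∀ x → Unique (f x)) →
  (∀ {x y z} → z ∈ f x → z ∈ f y → x ≡ y) → Unique (concatMap f xs)
unique-concatMap f {[]}     _            _  _        = []
unique-concatMap f {x ∷ xs} (x∉xs ∷ xs!) f! disjoint =
  Unique.++⁺ (f! x) (unique-concatMap f xs! f! disjoint) separated
  where
    separated : ∀ {z} → ¬ (z ∈ f x × z ∈ concatMap f xs)
    separated (z∈fx , z∈fxs) with y , y∈xs , z∈fy ← find (∈-concatMap⁻ f {xs = xs} z∈fxs) =
      All.lookup x∉xs y∈xs (disjoint z∈fx z∈fy)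

length-≡-of-same-elements : ∀ {A : Set} {xs ys : List A} → Unique xs → Unique ys →
  (∀ {z} → z ∈ xs ⇔ z ∈ ys) → length xs ≡ length ys
length-≡-of-same-elements xs! ys! same = ↭-length (∼bag⇒↭ (unique∧set⇒bag xs! ys! same))

length-concatMap : ∀ {A B : Set} (f : A → List B) (xs : List A) →
  length (concatMap f xs) ≡ sum (map (λ x → length (f x)) xs)
length-concatMap f []       = refl
length-concatMap f (x ∷ xs) = trans (length-++ (f x)) (cong (length (f x) +_) (length-concatMap f xs))

length-∷ʳ : ∀ (w : List ℕ) a → length (w ∷ʳ a) ≡ suc (length w)
length-∷ʳ w a = trans (length-++ w) (+-comm (length w) 1)

∈-wordsOfLength⁻ : ∀ n l {w} → w ∈ wordsOfLength n l → length w ≡ l × All (_∈ letters n) w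
∈-wordsOfLength⁻ n zero    (here refl) = refl , []
∈-wordsOfLength⁻ n (suc l) w∈
  with a , a∈ , w∈a∷ ← find (∈-concatMap⁻ (λ a → map (a ∷_) (wordsOfLength n l)) {xs = letters n} w∈)
  with w′ , w′∈ , refl ← ∈-map⁻ (a ∷_) w∈a∷ =
  Product.map (cong suc) (a∈ ∷_) (∈-wordsOfLength⁻ n l w′∈)

∈-wordsOfLength⁺ : ∀ n {w} → All (_∈ letters n) w → w ∈ wordsOfLength n (length w)
∈-wordsOfLength⁺ n {[]}    []         = here refl
∈-wordsOfLength⁺ n {a ∷ w} (a∈ ∷ w∈*) =
  ∈-concatMap⁺ (λ b → map (b ∷_) (wordsOfLength n (length w))) {xs = letters n}
    (lose a∈ (∈-map⁺ (_ ∷_) (∈-wordsOfLength⁺ n w∈*)))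

wordsOfLength-unique : ∀ n l → Unique (wordsOfLength n l)
wordsOfLength-unique n zero    = [] ∷ []
wordsOfLength-unique n (suc l) = unique-concatMap (λ a → map (a ∷_) (wordsOfLength n l)) (letters-unique n)
  (λ a → Unique.map⁺ ∷-injectiveʳ (wordsOfLength-unique n l)) same-head
  where
    same-head : ∀ {a b w} → w ∈ map (a ∷_) (wordsOfLength n l) → w ∈ map (b ∷_) (wordsOfLength n l) →
      a ≡ b
    same-head w∈a w∈b with _ , _ , refl ← ∈-map⁻ _ w∈a with _ , _ , refl ← ∈-map⁻ _ w∈b = refl

record IsReducedWord (n : ℕ) (π w : List ℕ) : Set where
  constructor reduced
  field
    length≡inv : length w ≡ inv π
    letters∈   : All (_∈ letters n) w
    evalWord≡  : evalWord n w ≡ π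

∈-reducedWords⁻ : ∀ n π {w} → w ∈ reducedWords n π → IsReducedWord n π w
∈-reducedWords⁻ n π w∈
  with w∈words , ev ← ∈-filter⁻ (λ w → evalWord n w ≟L π) {xs = wordsOfLength n (inv π)} w∈
  with len , w∈* ← ∈-wordsOfLength⁻ n (inv π) w∈words = reduced len w∈* ev

∈-reducedWords⁺ : ∀ n π {w} → IsReducedWord n π w → w ∈ reducedWords n π
∈-reducedWords⁺ n π (reduced len w∈* ev) =
  ∈-filter⁺ (λ w → evalWord n w ≟L π)
    (subst (λ l → _ ∈ wordsOfLength n l) len (∈-wordsOfLength⁺ n w∈*)) ev

reducedWords-unique : ∀ n π → Unique (reducedWords n π)
reducedWords-unique n π = Unique.filter⁺ (λ w → evalWord n w ≟L π) (wordsOfLength-unique n (inv π))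

evalWord-∷ʳ : ∀ n w a → evalWord n (w ∷ʳ a) ≡ evalWord n w ·s a
evalWord-∷ʳ n w a = foldl-++ _·s_ (idPerm n) w [ a ]

∷ʳ-∈reducedWords⁺ : ∀ {n π a w} → IsPerm n π → a ∈ Des n π → w ∈ reducedWords n (π ·s a) →
  w ∷ʳ a ∈ reducedWords n π
∷ʳ-∈reducedWords⁺ {n} {π} {a} {w} π-perm a∈Des w∈
  with reduced len w∈* ev ← ∈-reducedWords⁻ n (π ·s a) w∈ =
  ∈-reducedWords⁺ n π (reduced len′ (∷ʳ⁺ w∈* (proj₁ (∈-Des⁻ n π a∈Des))) ev′)
  where
    len′ : length (w ∷ʳ a) ≡ inv π
    len′ = trans (length-∷ʳ w a) (trans (cong suc len) (sym (inv-swapAt-descent π-perm a∈Des)))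
    ev′ : evalWord n (w ∷ʳ a) ≡ π
    ev′ = trans (evalWord-∷ʳ n w a) (trans (cong (_·s a) ev) (swapAt-involutive a π))

∷ʳ-∈reducedWords⁻ : ∀ {n π a w} → IsPerm n π → w ∷ʳ a ∈ reducedWords n π →
  a ∈ Des n π × w ∈ reducedWords n (π ·s a)
∷ʳ-∈reducedWords⁻ {n} {π} {a} {w} π-perm w∷a∈
  with reduced len w∷a∈* ev ← ∈-reducedWords⁻ n π w∷a∈
  with w∈* , a∈ ← ∷ʳ⁻ w∷a∈* = a∈Des , ∈-reducedWords⁺ n (π ·s a) (reduced len′ w∈* ev′)
  where
    ev′ : evalWord n w ≡ π ·s a
    ev′ = trans (sym (swapAt-involutive a (evalWord n w))) (cong (_·s a) (trans (sym (evalWord-∷ʳ n w a)) ev))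
    inv≡ : inv π ≡ suc (length w)
    inv≡ = trans (sym len) (length-∷ʳ w a)
    -- The last letter cannot be an ascent: a word of length ℓ(π) − 1 has product of length ≤ ℓ(π) − 1.
    a∈Des : a ∈ Des n π
    a∈Des with descent-or-lengthens π-perm a∈
    ... | inj₁ a∈Des    = a∈Des
    ... | inj₂ lengthens = contradiction
      (subst (_≤ length w) (trans (cong inv ev′) (trans lengthens (cong suc inv≡))) (inv-evalWord-≤ n w))
      λ 2+len≤len → <-irrefl refl (≤-trans 2+len≤len (n≤1+n _))
    len′ : length w ≡ inv (π ·s a)
    len′ = suc-injective (trans (sym inv≡) (inv-swapAt-descent π-perm a∈Des))

data CommMove : List ℕ → List ℕ → Set where
  move : ∀ p a b q → 1 < ∣ a - b ∣ → CommMove (p ++ a ∷ b ∷ q) (p ++ b ∷ a ∷ q)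

CommMove-cons : ∀ x {u v} → CommMove u v → CommMove (x ∷ u) (x ∷ v)
CommMove-cons x (move p a b q far) = move (x ∷ p) a b q far

commNbrs⁻ : ∀ u {v} → v ∈ commNbrs u → CommMove u v
commNbrs⁻ (a ∷ b ∷ s) v∈ with 1 <ᵇ ∣ a - b ∣ in far?
... | true with ∈-++⁻ [ b ∷ a ∷ s ] v∈
...   | inj₁ (here refl) = move [] a b s (<ᵇ⇒< 1 ∣ a - b ∣ (subst T (sym far?) tt))
...   | inj₂ v∈shifted with _ , v′∈ , refl ← ∈-map⁻ (a ∷_) v∈shifted =
  CommMove-cons a (commNbrs⁻ (b ∷ s) v′∈)
commNbrs⁻ (a ∷ b ∷ s) v∈ | false with _ , v′∈ , refl ← ∈-map⁻ (a ∷_) v∈ =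
  CommMove-cons a (commNbrs⁻ (b ∷ s) v′∈)

commNbrs-cons : ∀ x u {v} → v ∈ commNbrs u → x ∷ v ∈ commNbrs (x ∷ u)
commNbrs-cons x (y ∷ s) v∈ = ∈-++⁺ʳ _ (∈-map⁺ (x ∷_) v∈)

commNbrs⁺ : ∀ p {a b} q → 1 < ∣ a - b ∣ → p ++ b ∷ a ∷ q ∈ commNbrs (p ++ a ∷ b ∷ q)
commNbrs⁺ []      {a} {b} q far with 1 <ᵇ ∣ a - b ∣ | <⇒<ᵇ far
... | true | _ = here refl
commNbrs⁺ (x ∷ p) {a} {b} q far = commNbrs-cons x (p ++ a ∷ b ∷ q) (commNbrs⁺ p q far)

commNbrs-sym : ∀ u {v} → v ∈ commNbrs u → u ∈ commNbrs v
commNbrs-sym u v∈ with move p a b q far ← commNbrs⁻ u v∈ = commNbrs⁺ p q (subst (1 <_) (∣-∣-comm a b) far)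

-- The subgraph G(σ s_i) of G(σ), for a descent i of σ

module Cover {n : ℕ} {σ : List ℕ} {i : ℕ} (σ-perm : IsPerm n σ) (i∈ : i ∈ letters n)
             (shortens : inv σ ≡ suc (inv (σ ·s i))) where

  τ : List ℕ
  τ = σ ·s i

  τ-perm : IsPerm n τ
  τ-perm = IsPerm-swapAt i σ-perm

  i∈Des : i ∈ Des n σ
  i∈Des with descent-or-lengthens σ-perm i∈
  ... | inj₁ i∈Des     = i∈Des
  ... | inj₂ lengthens = contradiction (trans lengthens (cong suc shortens)) (m≢1+n+m (inv τ) {1})

  ∷ʳi-∈G[τ] : ∀ {t} → t ∷ʳ i ∈ reducedWords n σ → InSub n τ i (t ∷ʳ i)
  ∷ʳi-∈G[τ] t∷i∈ = ∈-map⁺ (_++ [ i ]) (proj₂ (∷ʳ-∈reducedWords⁻ σ-perm t∷i∈))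

  -- A move away from the last letter keeps the word ending in i.
  move-from-G[τ] : ∀ p a b q → InSub n τ i (p ++ a ∷ b ∷ q) → p ++ b ∷ a ∷ q ∈ reducedWords n σ →
    InSub n τ i (p ++ b ∷ a ∷ q) ⊎ (q ≡ [] × b ≡ i × p ∷ʳ a ∈ reducedWords n τ)
  move-from-G[τ] p a b q u∈G v∈ with t , t∈ , u≡ ← ∈-map⁻ (_++ [ i ]) u∈G | initLast q
  ... | [] with p∷a≡t , refl ← ∷ʳ-injective (p ∷ʳ a) t (trans (∷ʳ-++ p a [ b ]) u≡) =
    inj₂ (refl , refl , subst (_∈ reducedWords n τ) (sym p∷a≡t) t∈)
  ... | q′ ∷ʳ′ c
    with refl ← ∷ʳ-injectiveʳ (p ++ a ∷ b ∷ q′) t (trans (++-assoc p (a ∷ b ∷ q′) [ c ]) u≡) =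
    inj₁ (subst (InSub n τ i) (++-assoc p (b ∷ a ∷ q′) [ i ])
      (∷ʳi-∈G[τ] (subst (_∈ reducedWords n σ) (sym (++-assoc p (b ∷ a ∷ q′) [ i ])) v∈)))

  lastSwap-∈Iset : ∀ {p a} → 1 < ∣ a - i ∣ → p ++ i ∷ a ∷ [] ∈ reducedWords n σ → a ∈ Iset n σ i
  lastSwap-∈Iset {p} {a} far v∈ =
    ∈-Iset⁺ n σ i (proj₁ (∷ʳ-∈reducedWords⁻ σ-perm v∈′)) far
    where
      v∈′ : p ∷ʳ i ∷ʳ a ∈ reducedWords n σ
      v∈′ = subst (_∈ reducedWords n σ) (sym (∷ʳ-++ p i [ a ])) v∈

  commNbr-∈G[τ] : Iset n σ i ≡ [] → ∀ {u v} → InSub n τ i u → v ∈ reducedWords n σ → v ∈ commNbrs u →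
    InSub n τ i v
  commNbr-∈G[τ] noFar {u} u∈G v∈ v∈nbrs with move p a b q far ← commNbrs⁻ u v∈nbrs
    with move-from-G[τ] p a b q u∈G v∈
  ... | inj₁ v∈G              = v∈G
  ... | inj₂ (refl , refl , _) = contradiction (subst (a ∈_) noFar (lastSwap-∈Iset far v∈)) λ ()

  commEdge-closed : Iset n σ i ≡ [] → (u v : List ℕ) → CommEdge n σ u v →
    InSub n τ i u ⊎ InSub n τ i v → InSub n τ i u × InSub n τ i v
  commEdge-closed noFar u v (_  , v∈ , v∈nbrs) (inj₁ u∈G) = u∈G , commNbr-∈G[τ] noFar u∈G v∈ v∈nbrs
  commEdge-closed noFar u v (u∈ , _  , v∈nbrs) (inj₂ v∈G) =
    commNbr-∈G[τ] noFar v∈G u∈ (commNbrs-sym u v∈nbrs) , v∈G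

  BoundaryEdge : List ℕ × List ℕ → Set
  BoundaryEdge (u , v) = InSub n τ i u × ¬ InSub n τ i v × v ∈ commNbrs u

  boundaryEdge : ℕ → List ℕ → List ℕ × List ℕ
  boundaryEdge j w = (w ∷ʳ j ∷ʳ i , w ∷ʳ i ∷ʳ j)

  boundaryEdgesVia : ℕ → List (List ℕ × List ℕ)
  boundaryEdgesVia j = map (boundaryEdge j) (reducedWords n (τ ·s j))

  boundaryEdges : List (List ℕ × List ℕ)
  boundaryEdges = concatMap boundaryEdgesVia (Iset n σ i)

  boundaryEdge-injective : ∀ {j j′ w w′} → boundaryEdge j w ≡ boundaryEdge j′ w′ → w ≡ w′ × j ≡ j′
  boundaryEdge-injective {j} {j′} {w} {w′} eq =
    ∷ʳ-injective w w′ (∷ʳ-injectiveˡ (w ∷ʳ j) (w′ ∷ʳ j′) (cong proj₁ eq))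

  boundaryEdges-unique : Unique boundaryEdges
  boundaryEdges-unique = unique-concatMap boundaryEdgesVia (Iset-unique n σ i)
    (λ j → Unique.map⁺ (λ eq → proj₁ (boundaryEdge-injective eq)) (reducedWords-unique n (τ ·s j)))
    same-letter
    where
      same-letter : ∀ {j j′ z} → z ∈ boundaryEdgesVia j → z ∈ boundaryEdgesVia j′ → j ≡ j′
      same-letter z∈ z∈′ with _ , _ , refl ← ∈-map⁻ _ z∈ with _ , _ , eq ← ∈-map⁻ _ z∈′ =
        proj₂ (boundaryEdge-injective eq)

  length-boundaryEdges : length boundaryEdges ≡ sum (map (λ j → length (reducedWords n (τ ·s j))) (Iset n σ i))
  length-boundaryEdges = trans (length-concatMap boundaryEdgesVia (Iset n σ i))
    (cong sum (map-cong (λ j → length-map (boundaryEdge j) (reducedWords n (τ ·s j))) (Iset n σ i)))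

  boundaryEdge-isBoundary : ∀ {j w} → j ∈ Iset n σ i → w ∈ reducedWords n (τ ·s j) →
    boundaryEdge j w ∈ cartesianProduct (reducedWords n σ) (reducedWords n σ) × BoundaryEdge (boundaryEdge j w)
  boundaryEdge-isBoundary {j} {w} j∈I w∈ with j∈Des , far ← ∈-Iset⁻ n σ i j∈I =
    ∈-cartesianProduct⁺ u∈ v∈ , ∈-map⁺ (_++ [ i ]) w∷j∈ , v∉G , v∈nbrs
    where
      w∷j∈ : w ∷ʳ j ∈ reducedWords n τ
      w∷j∈ = ∷ʳ-∈reducedWords⁺ τ-perm (Des-swapAt-far n σ far j∈Des) w∈
      u∈ : w ∷ʳ j ∷ʳ i ∈ reducedWords n σ
      u∈ = ∷ʳ-∈reducedWords⁺ σ-perm i∈Des w∷j∈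
      w∷i∈ : w ∷ʳ i ∈ reducedWords n (σ ·s j)
      w∷i∈ = ∷ʳ-∈reducedWords⁺ (IsPerm-swapAt j σ-perm)
        (Des-swapAt-far n σ (subst (1 <_) (∣-∣-comm j i) far) i∈Des)
        (subst (λ π → w ∈ reducedWords n π) (swapAt-comm j i σ far) w∈)
      v∈ : w ∷ʳ i ∷ʳ j ∈ reducedWords n σ
      v∈ = ∷ʳ-∈reducedWords⁺ σ-perm j∈Des w∷i∈
      v∉G : ¬ InSub n τ i (w ∷ʳ i ∷ʳ j)
      v∉G v∈G with t , _ , v≡ ← ∈-map⁻ (_++ [ i ]) v∈G =
        far-apart⇒≢ j i far (∷ʳ-injectiveʳ (w ∷ʳ i) t v≡)
      v∈nbrs : w ∷ʳ i ∷ʳ j ∈ commNbrs (w ∷ʳ j ∷ʳ i)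
      v∈nbrs = subst₂ (λ u v → v ∈ commNbrs u) (sym (∷ʳ-++ w j [ i ])) (sym (∷ʳ-++ w i [ j ]))
                      (commNbrs⁺ w [] far)

  boundary-∈boundaryEdges : ∀ {u v} → v ∈ reducedWords n σ → BoundaryEdge (u , v) → (u , v) ∈ boundaryEdges
  boundary-∈boundaryEdges {u} v∈ (u∈G , v∉G , v∈nbrs) with move p a b q far ← commNbrs⁻ u v∈nbrs
    with move-from-G[τ] p a b q u∈G v∈
  ... | inj₁ v∈G                = contradiction v∈G v∉G
  ... | inj₂ (refl , refl , p∷a∈) = ∈-concatMap⁺ boundaryEdgesVia {xs = Iset n σ i}
    (lose (lastSwap-∈Iset far v∈)
      (subst (_∈ boundaryEdgesVia a) (cong₂ _,_ (∷ʳ-++ p a [ i ]) (∷ʳ-++ p i [ a ]))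
        (∈-map⁺ (boundaryEdge a) (proj₂ (∷ʳ-∈reducedWords⁻ τ-perm p∷a∈)))))

  -- Stated for an arbitrary decidable P so that the anonymous predicate filtered in
  -- boundaryCommEdges can be inferred by unification.
  length-filter-boundary : ∀ {P : List ℕ × List ℕ → Set} (P? : Decidable P) →
    (∀ {z} → P z ⇔ BoundaryEdge z) →
    length (filter P? (cartesianProduct (reducedWords n σ) (reducedWords n σ))) ≡ length boundaryEdges
  length-filter-boundary P? P⇔boundary = length-≡-of-same-elements
    (Unique.filter⁺ P? (Unique.cartesianProduct⁺ (reducedWords-unique n σ) (reducedWords-unique n σ)))
    boundaryEdges-unique (mk⇔ to from)
    where
      to : ∀ {z} → z ∈ filter P? (cartesianProduct (reducedWords n σ) (reducedWords n σ)) → z ∈ boundaryEdges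
      to z∈ with z∈× , Pz ← ∈-filter⁻ P? {xs = cartesianProduct (reducedWords n σ) (reducedWords n σ)} z∈
        with _ , v∈ ← ∈-cartesianProduct⁻ (reducedWords n σ) (reducedWords n σ) z∈× =
        boundary-∈boundaryEdges v∈ (Equivalence.to P⇔boundary Pz)
      from : ∀ {z} → z ∈ boundaryEdges → z ∈ filter P? (cartesianProduct (reducedWords n σ) (reducedWords n σ))
      from z∈ with j , j∈I , z∈via ← find (∈-concatMap⁻ boundaryEdgesVia {xs = Iset n σ i} z∈)
        with w , w∈ , refl ← ∈-map⁻ (boundaryEdge j) z∈via
        with z∈× , boundary ← boundaryEdge-isBoundary j∈I w∈ =
        ∈-filter⁺ P? z∈× (Equivalence.from P⇔boundary boundary)

  boundaryCommEdges≡ :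
    boundaryCommEdges n σ τ i ≡ sum (map (λ j → length (reducedWords n (τ ·s j))) (Iset n σ i))
  boundaryCommEdges≡ = trans (length-filter-boundary _ (mk⇔ id id)) length-boundaryEdges

proposition4p10 : (n : ℕ) → 2 ≤ n → (σ τ : List ℕ) → IsPerm n σ → IsPerm n τ →
    (i : ℕ) → 1 ≤ i → i < n → τ ·s i ≡ σ → inv σ ≡ suc (inv τ) →
    (Iset n σ i ≢ [] →
      boundaryCommEdges n σ τ i
        ≡ sum (map (λ j → length (reducedWords n ((σ ·s i) ·s j))) (Iset n σ i)))
    × (Iset n σ i ≡ [] →
      (u v : List ℕ) → CommEdge n σ u v → (InSub n τ i u ⊎ InSub n τ i v) →
      InSub n τ i u × InSub n τ i v)
proposition4p10 n _ σ τ σ-perm _ i 1≤i i<n τ·i≡σ inv≡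
  with refl ← trans (sym (swapAt-involutive i τ)) (cong (_·s i) τ·i≡σ) =
  (λ _ → boundaryCommEdges≡) , commEdge-closed
  where open Cover σ-perm (∈-letters⁺ 1≤i i<n) inv≡
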